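{- Every graph $G$ without isolated vertices satisfies $\chi_o(G)\le \gamma_t(G)+\chi(G)$.
   Context: All graphs are finite, simple and undirected. $\chi$ denotes the ordinary chromatic number. A set $S\subseteq V(G)$ is a total dominating set if every vertex of $G$ has a neighbor in $S$; $\gamma_t(G)$ is the minimum size of a total dominating set. A proper vertex coloring $\varphi$ of a graph $G$ is called an odd coloring if for every non-isolated vertex $x$ of $G$ there is a color $c$ such that the number of neighbors $y\in N(x)$ with $\varphi(y)=c$ is odd. The odd chromatic number $\chi_o(G)$ is the minimum number of colors in an odd coloring of $G$. -}

module Defs where

open import Data.Nat using (ℕ; _+_; _≤_)
open import Data.Nat.Properties using ()
open import Data.Fin using (Fin; _≟_)
open import Data.Fin.Subset using (Subset; _∈_; ∣_∣)
open import Data.Bool using (Bool; true; false; _∧_)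
open import Data.List using (List; length; filter; allFin)
open import Data.Product using (Σ; ∃; _×_; _,_)
open import Relation.Nullary using (¬_)
open import Relation.Nullary.Decidable using (⌊_⌋)
open import Relation.Binary.PropositionalEquality using (_≡_; _≢_)
open import Data.Bool.Properties using (T?)
open import Data.Nat using (_%_)

record Graph (n : ℕ) : Set where
  field
    adj    : Fin n → Fin n → Bool
    sym    : ∀ x y → adj x y ≡ adj y x
    irrefl : ∀ x → adj x x ≡ false
open Graph public

Adjacent : ∀ {n} → Graph n → Fin n → Fin n → Set
Adjacent G x y = adj G x y ≡ true

NonIsolated : ∀ {n} → Graph n → Fin n → Set
NonIsolated G x = ∃ λ y → Adjacent G x y

NoIsolatedVertices : ∀ {n} → Graph n → Set
NoIsolatedVertices {n} G = ∀ (x : Fin n) → NonIsolated G x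

Proper : ∀ {n} → Graph n → (k : ℕ) → (Fin n → Fin k) → Set
Proper G k φ = ∀ x y → Adjacent G x y → φ x ≢ φ y

nbrColorCount : ∀ {n k} → Graph n → (Fin n → Fin k) → Fin n → Fin k → ℕ
nbrColorCount {n} G φ x c =
  length (filter (λ y → T? (adj G x y ∧ ⌊ φ y ≟ c ⌋)) (allFin n))

Odd : ℕ → Set
Odd m = m % 2 ≡ 1

OddColoring : ∀ {n} → Graph n → (k : ℕ) → (Fin n → Fin k) → Set
OddColoring {n} G k φ =
  Proper G k φ × (∀ (x : Fin n) → NonIsolated G x → ∃ λ c → Odd (nbrColorCount G φ x c))

Colorable : ∀ {n} → Graph n → ℕ → Set
Colorable {n} G k = ∃ λ (φ : Fin n → Fin k) → Proper G k φ

OddColorable : ∀ {n} → Graph n → ℕ → Set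
OddColorable {n} G k = ∃ λ (φ : Fin n → Fin k) → OddColoring G k φ

TotalDominating : ∀ {n} → Graph n → Subset n → Set
TotalDominating {n} G S = ∀ (x : Fin n) → ∃ λ y → Adjacent G x y × y ∈ S

IsChromaticNumber : ∀ {n} → Graph n → ℕ → Set
IsChromaticNumber G k = Colorable G k × (∀ j → Colorable G j → k ≤ j)

IsTotalDominationNumber : ∀ {n} → Graph n → ℕ → Set
IsTotalDominationNumber {n} G t =
  (∃ λ S → TotalDominating G S × ∣ S ∣ ≡ t) ×
  (∀ S → TotalDominating G S → t ≤ ∣ S ∣)

IsOddChromaticNumber : ∀ {n} → Graph n → ℕ → Set
IsOddChromaticNumber G k = OddColorable G k × (∀ j → OddColorable G j → k ≤ j)

-- Color a total dominating set S with |S| fresh colors, one per vertex, and all other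
-- vertices by a proper χ(G)-coloring. The result is proper, and every vertex x has a
-- neighbour in S whose color is used nowhere else, so that color occurs exactly once
-- in N(x).
module Submission where

open import Defs hiding (sym)
open import Data.Nat using (ℕ; _+_; _≤_; _%_)
open import Data.Fin using (Fin; zero; suc; join; splitAt; _≟_)
open import Data.Fin.Properties using (splitAt-join)
open import Data.Fin.Subset using (Subset; _∈_; ∣_∣)
open import Data.Vec using (_∷_; here; there)
open import Data.Bool using (true; false; _∧_)
open import Data.Bool.Properties using (T?; T-∧; T-≡)
open import Data.Maybe using (Maybe; just; nothing; map)
open import Data.Sum using (_⊎_; inj₁; inj₂)
open import Data.Product using (∃; _×_; _,_; proj₂)
open import Data.List using (List; []; _∷_; length; filter)
open import Data.List.Membership.Propositional using () renaming (_∈_ to _∈ₗ_)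
open import Data.List.Membership.Propositional.Properties using (∈-allFin; ∈-filter⁺; ∈-filter⁻)
open import Data.List.Relation.Unary.Any using (here; there)
open import Data.List.Relation.Unary.All using (_∷_)
open import Data.List.Relation.Unary.Unique.Propositional using (Unique; _∷_)
open import Data.List.Relation.Unary.Unique.Propositional.Properties using (allFin⁺; filter⁺)
open import Function using (_∘_; Injective)
open import Function.Bundles using (Equivalence)
open import Relation.Nullary using (contradiction)
open import Relation.Nullary.Decidable using (⌊_⌋; toWitness; fromWitness)
open import Relation.Unary using (Pred; Decidable)
open import Relation.Binary.PropositionalEquality using (_≡_; _≢_; refl; sym; trans; cong; module ≡-Reasoning)

private
  variable
    n k : ℕ

length-unique-≡-1 : ∀ {a} {A : Set a} {xs : List A} {y : A} → Unique xs → y ∈ₗ xs →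
                    (∀ {z} → z ∈ₗ xs → z ≡ y) → length xs ≡ 1
length-unique-≡-1 {xs = _ ∷ []}    _               _ _   = refl
length-unique-≡-1 {xs = _ ∷ _ ∷ _} ((a≢b ∷ _) ∷ _) _ ≡y =
  contradiction (trans (≡y (here refl)) (sym (≡y (there (here refl))))) a≢b

length-filter-≡-1 : ∀ {a p} {A : Set a} {P : Pred A p} (P? : Decidable P)
                    {xs : List A} {y : A} → Unique xs → y ∈ₗ xs → P y →
                    (∀ {z} → P z → z ≡ y) → length (filter P? xs) ≡ 1
length-filter-≡-1 P? {xs} uniq y∈xs Py onlyY =
  length-unique-≡-1 (filter⁺ P? uniq) (∈-filter⁺ P? y∈xs Py)
                    (onlyY ∘ proj₂ ∘ ∈-filter⁻ P? {xs = xs})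

join-injective : ∀ m n → Injective _≡_ _≡_ (join m n)
join-injective m n {i} {j} eq = begin
  i                        ≡⟨ splitAt-join m n i ⟨
  splitAt m (join m n i)   ≡⟨ cong (splitAt m) eq ⟩
  splitAt m (join m n j)   ≡⟨ splitAt-join m n j ⟩
  j                        ∎
  where open ≡-Reasoning

adjacent⇒≢ : (G : Graph n) {x y : Fin n} → Adjacent G x y → x ≢ y
adjacent⇒≢ G {x} axx refl with trans (sym axx) (irrefl G x)
... | ()

UniquelyColored : ∀ {c} {C : Set c} → (Fin n → C) → Fin n → Set c
UniquelyColored φ y = ∀ z → φ z ≡ φ y → z ≡ y

uniquelyColored-∘ : ∀ {c d} {C : Set c} {D : Set d} {f : C → D} {φ : Fin n → C} {y : Fin n} →
                    Injective _≡_ _≡_ f → UniquelyColored φ y → UniquelyColored (f ∘ φ) y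
uniquelyColored-∘ f-inj unique z = unique z ∘ f-inj

nbrColorCount-uniquelyColored : (G : Graph n) (φ : Fin n → Fin k) {x y : Fin n} →
                                Adjacent G x y → UniquelyColored φ y →
                                nbrColorCount G φ x (φ y) ≡ 1
nbrColorCount-uniquelyColored {n} G φ {x} {y} axy unique =
  length-filter-≡-1 (λ z → T? (adj G x z ∧ ⌊ φ z ≟ φ y ⌋)) (allFin⁺ n) (∈-allFin y)
    (Equivalence.from T-∧ (Equivalence.from T-≡ axy , fromWitness refl))
    (λ {z} Pz → unique z (toWitness (proj₂ (Equivalence.to (T-∧ {adj G x z}) Pz))))

oddColoring-fromUniquelyColoredNeighbours :
  (G : Graph n) (φ : Fin n → Fin k) → Proper G k φ →
  (∀ x → ∃ λ y → Adjacent G x y × UniquelyColored φ y) → OddColoring G k φ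
oddColoring-fromUniquelyColoredNeighbours G φ proper nbr = proper , odd
  where
  odd : ∀ x → NonIsolated G x → ∃ λ c → Odd (nbrColorCount G φ x c)
  odd x _ with nbr x
  ... | y , axy , unique = φ y , cong (_% 2) (nbrColorCount-uniquelyColored G φ axy unique)

index : (S : Subset n) → Fin n → Maybe (Fin ∣ S ∣)
index (true  ∷ S) zero    = just zero
index (true  ∷ S) (suc y) = map suc (index S y)
index (false ∷ S) zero    = nothing
index (false ∷ S) (suc y) = index S y

element : (S : Subset n) → Fin ∣ S ∣ → Fin n
element (true  ∷ S) zero    = zero
element (true  ∷ S) (suc i) = suc (element S i)
element (false ∷ S) i       = suc (element S i)

index-∈ : (S : Subset n) {y : Fin n} → y ∈ S → ∃ λ i → index S y ≡ just i
index-∈ (true  ∷ S) here = zero , refl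
index-∈ (true  ∷ S) (there y∈S) with index-∈ S y∈S
... | i , index≡ = suc i , cong (map suc) index≡
index-∈ (false ∷ S) (there y∈S) = index-∈ S y∈S

element-index : (S : Subset n) (y : Fin n) {i : Fin ∣ S ∣} →
                index S y ≡ just i → element S i ≡ y
element-index (true  ∷ S) zero refl = refl
element-index (true  ∷ S) (suc y) eq with index S y in index≡
... | just j with refl ← eq = cong suc (element-index S y index≡)
element-index (false ∷ S) (suc y) eq = cong suc (element-index S y eq)

dominatorColoring : (S : Subset n) → (Fin n → Fin k) → Fin n → Fin ∣ S ∣ ⊎ Fin k
dominatorColoring S c y with index S y
... | just i  = inj₁ i
... | nothing = inj₂ (c y)

module _ (S : Subset n) (c : Fin n → Fin k) where

  private
    ψ = dominatorColoring S c

  dominatorColoring-inj₁ : ∀ z {i} → ψ z ≡ inj₁ i → element S i ≡ z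
  dominatorColoring-inj₁ z eq with index S z in index≡
  ... | just j with refl ← eq = element-index S z index≡

  dominatorColoring-inj₂ : ∀ z {a} → ψ z ≡ inj₂ a → c z ≡ a
  dominatorColoring-inj₂ z eq with index S z
  ... | nothing with refl ← eq = refl

  dominatorColoring-index : ∀ y {i} → index S y ≡ just i → ψ y ≡ inj₁ i
  dominatorColoring-index y index≡ rewrite index≡ = refl

  dominatorColoring-∈ : ∀ {y} → y ∈ S → UniquelyColored ψ y
  dominatorColoring-∈ {y} y∈S z ψz≡ψy with index-∈ S y∈S
  ... | i , index≡ =
    trans (sym (dominatorColoring-inj₁ z (trans ψz≡ψy ψy≡))) (dominatorColoring-inj₁ y ψy≡)
    where ψy≡ = dominatorColoring-index y index≡

  dominatorColoring-proper : (G : Graph n) → Proper G k c →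
                             ∀ {x y} → Adjacent G x y → ψ x ≢ ψ y
  dominatorColoring-proper G c-proper {x} {y} axy ψx≡ψy with ψ x in ψx≡ | ψ y in ψy≡
  ... | inj₁ _ | inj₁ _ with refl ← ψx≡ψy =
    adjacent⇒≢ G axy
      (trans (sym (dominatorColoring-inj₁ x ψx≡)) (dominatorColoring-inj₁ y ψy≡))
  ... | inj₂ _ | inj₂ _ with refl ← ψx≡ψy =
    c-proper x y axy
      (trans (dominatorColoring-inj₂ x ψx≡) (sym (dominatorColoring-inj₂ y ψy≡)))

oddColorable-+ : (G : Graph n) (S : Subset n) → TotalDominating G S → Colorable G k →
                 OddColorable G (∣ S ∣ + k)
oddColorable-+ {k = k} G S dominating (c , c-proper) =
  φ , oddColoring-fromUniquelyColoredNeighbours G φ proper privateNbr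
  where
  φ = join ∣ S ∣ k ∘ dominatorColoring S c

  proper : Proper G (∣ S ∣ + k) φ
  proper x y axy = dominatorColoring-proper S c G c-proper axy ∘ join-injective ∣ S ∣ k

  privateNbr : ∀ x → ∃ λ y → Adjacent G x y × UniquelyColored φ y
  privateNbr x with dominating x
  ... | y , axy , y∈S =
    y , axy , uniquelyColored-∘ (join-injective ∣ S ∣ k) (dominatorColoring-∈ S c y∈S)

mainTheorem8 : ∀ {n : ℕ} (G : Graph n) → NoIsolatedVertices G →
               ∀ (χo γt χ : ℕ) →
               IsOddChromaticNumber G χo → IsTotalDominationNumber G γt → IsChromaticNumber G χ →
               χo ≤ γt + χ
-- A total dominating set already rules out isolated vertices.
mainTheorem8 G _ χo γt χ (_ , χo-minimal) ((S , dominating , refl) , _) (colorable , _) =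
  χo-minimal (∣ S ∣ + χ) (oddColorable-+ G S dominating colorable)
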